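{- Let $G=(V_1,V_2,\ldots,V_p,E)$ be a finite $p$-partite graph and let $k_1,\ldots,k_p$ be nonnegative integers. Run the algorithm \textsc{p-partiteGraphPeel}$(G,(k_1,\ldots,k_p))$ described below. Then the graph it outputs equals $G(k_1,k_2,\ldots,k_p)$, the largest subgraph of $G$ in which every vertex lying in $V_i$ has degree at least $k_i$, for every $1\le i\le p$.
   Context: A $p$-partite graph $G=(V_1,\ldots,V_p,E)$ is a graph whose vertex set is partitioned into $p$ disjoint sets $V_1,\ldots,V_p$ such that no edge joins two vertices of the same $V_i$. For a vertex $u$, let $p(u)$ denote the index with $u\in V_{p(u)}$. A $(k_1,\ldots,k_p)$-degree graph is a $p$-partite graph in which every vertex of $V_i$ has degree at least $k_i$ (the $V_i$ may be empty). $G(k_1,\ldots,k_p)$ denotes the largest $(k_1,\ldots,k_p)$-degree graph that is a subgraph of $G$; it is unique when it exists. Algorithm \textsc{p-partiteGraphPeel}: (1) mark every vertex active; (2) set $Counter(v)=\deg_G(v)$ for every $v$; (3) for $i=1,\ldots,p$ and for each $v\in V_i$ in turn: if $v$ is active and $Counter(v)<k_i$, mark $v$ inactive, put $v$ into an empty queue $Q$, and then while $Q\neq\emptyset$: dequeue a vertex $w$, and for every neighbor $u$ of $w$, decrease $Counter(u)$ by $1$, and if $u$ is active and $Counter(u)<k_{p(u)}$, mark $u$ inactive and enqueue $u$; (4) output the subgraph of $G$ induced by the active vertices. -}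

module Defs where

open import Data.Bool using (Bool; true; false; _∧_; if_then_else_; not)
open import Data.Nat using (ℕ; zero; suc; _∸_; _≤_; _<ᵇ_)
open import Data.Fin using (Fin; _≟_)
open import Data.List using (List; []; _∷_; _++_; allFin; filterᵇ; length; concatMap; foldl)
open import Data.Product using (_×_; _,_; proj₁; proj₂)
open import Relation.Binary.PropositionalEquality using (_≡_; _≢_)
open import Relation.Nullary.Decidable using (⌊_⌋)

-- Vertices are Fin n; part v is the (0-based) index of the class V_i
-- containing v; adjacency is a symmetric Bool-valued relation with no
-- edge inside a class (hence no loops).

record PPartiteGraph (p : ℕ) : Set where
  field
    n        : ℕ
    part     : Fin n → Fin p
    adj      : Fin n → Fin n → Bool
    adj-sym  : ∀ u v → adj u v ≡ adj v u
    partite  : ∀ u v → adj u v ≡ true → part u ≢ part v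

open PPartiteGraph public

absurd : {A : Set} → false ≡ true → A
absurd ()

deg : ∀ {p} (G : PPartiteGraph p) → Fin (n G) → ℕ
deg G v = length (filterᵇ (adj G v) (allFin (n G)))

record Subgraph {p} (G : PPartiteGraph p) : Set where
  field
    W      : Fin (n G) → Bool
    F      : Fin (n G) → Fin (n G) → Bool
    F-sym  : ∀ u v → F u v ≡ F v u
    F⊆E    : ∀ u v → F u v ≡ true → adj G u v ≡ true
    F-ends : ∀ u v → F u v ≡ true → W u ≡ true

open Subgraph public

degIn : ∀ {p} {G : PPartiteGraph p} → Subgraph G → Fin (n G) → ℕ
degIn {G = G} H v = length (filterᵇ (F H v) (allFin (n G)))

IsDegreeGraph : ∀ {p} {G : PPartiteGraph p} → (Fin p → ℕ) → Subgraph G → Set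
IsDegreeGraph {G = G} k H = ∀ v → W H v ≡ true → k (part G v) ≤ degIn H v

_⊆G_ : ∀ {p} {G : PPartiteGraph p} → Subgraph G → Subgraph G → Set
H₁ ⊆G H₂ = (∀ v → W H₁ v ≡ true → W H₂ v ≡ true)
         × (∀ u v → F H₁ u v ≡ true → F H₂ u v ≡ true)

IsLargestDegreeSubgraph : ∀ {p} {G : PPartiteGraph p} → (Fin p → ℕ) → Subgraph G → Set
IsLargestDegreeSubgraph {G = G} k H =
  IsDegreeGraph k H × (∀ (H' : Subgraph G) → IsDegreeGraph k H' → H' ⊆G H)

module Peel {p : ℕ} (G : PPartiteGraph p) (k : Fin p → ℕ) where

  V : Set
  V = Fin (n G)

  -- algorithm state: active marks and counters
  State : Set
  State = (V → Bool) × (V → ℕ)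

  update : {A : Set} → (V → A) → V → A → V → A
  update f x a y = if ⌊ y ≟ x ⌋ then a else f y

  below : (V → ℕ) → V → Bool
  below c u = c u <ᵇ k (part G u)

  visit : State × List V → V → State × List V
  visit ((act , c) , q) u =
    let c' = update c u (c u ∸ 1) in
    if act u ∧ below c' u
      then ((update act u false , c') , q ++ (u ∷ []))
      else ((act , c') , q)

  processVertex : V → State × List V → State × List V
  processVertex w sq = foldl visit sq (filterᵇ (adj G w) (allFin (n G)))

  -- the while-loop on Q, with fuel.  Every vertex is enqueued at most
  -- once (it is marked inactive when enqueued), so fuel n suffices.
  loop : ℕ → State → List V → State
  loop zero    s q       = s
  loop (suc f) s []      = s
  loop (suc f) s (w ∷ q) =
    let r = processVertex w (s , q) in loop f (proj₁ r) (proj₂ r)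

  step : State → V → State
  step (act , c) v =
    if act v ∧ below c v
      then loop (n G) (update act v false , c) (v ∷ [])
      else (act , c)

  order : List V
  order = concatMap (λ i → filterᵇ (λ v → ⌊ part G v ≟ i ⌋) (allFin (n G))) (allFin p)

  initial : State
  initial = (λ _ → true) , deg G

  finalActive : V → Bool
  finalActive = proj₁ (foldl step initial order)

  output : Subgraph G
  output = record
    { W = finalActive
    ; F = λ u v → adj G u v ∧ finalActive u ∧ finalActive v
    ; F-sym = fsym
    ; F⊆E = f⊆e
    ; F-ends = fends
    }
    where
    open import Data.Bool.Properties using (∧-comm; ∧-assoc)
    open import Relation.Binary.PropositionalEquality using (cong₂; refl; trans; cong)
    fsym : ∀ u v → (adj G u v ∧ finalActive u ∧ finalActive v) ≡ (adj G v u ∧ finalActive v ∧ finalActive u)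
    fsym u v = cong₂ _∧_ (adj-sym G u v) (∧-comm (finalActive u) (finalActive v))
    f⊆e : ∀ u v → (adj G u v ∧ finalActive u ∧ finalActive v) ≡ true → adj G u v ≡ true
    f⊆e u v e with adj G u v
    ... | true = refl
    ... | false = e
    fends : ∀ u v → (adj G u v ∧ finalActive u ∧ finalActive v) ≡ true → finalActive u ≡ true
    fends u v e with adj G u v | finalActive u
    ... | true  | true = refl
    ... | true  | false = e
    ... | false | _ = absurd e

pPartiteGraphPeel : ∀ {p} (G : PPartiteGraph p) (k : Fin p → ℕ) → Subgraph G
pPartiteGraphPeel G k = Peel.output G k

-- Once the queue has been emptied, the counter of every vertex is the number of its active
-- neighbours, and every active vertex already examined in step (3) has a counter at least its
-- threshold: counters drop only inside the while loop, which re-examines the vertex at once.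
-- At the end every vertex has been examined, so the active vertices induce a
-- (k_1,…,k_p)-degree graph.  Conversely, a vertex of a (k_1,…,k_p)-degree subgraph with vertex
-- set S is never deactivated: its counter never falls below its number of neighbours not yet
-- dequeued, which include its at least k_i neighbours in S, since no vertex of S is ever dequeued.

module Submission where

open import Defs
open import Data.Bool using (Bool; true; false; _∧_; _∨_; not; T)
open import Data.Bool.Properties using (∧-zeroʳ; ∧-identityʳ; ∨-zeroʳ; ∨-identityʳ; ∧-distribˡ-∨)
open import Data.Empty using (⊥)
open import Data.Fin using (Fin; _≟_)
open import Data.List using (List; []; _∷_; _++_; allFin; filterᵇ; length; foldl)
open import Data.List.Properties using (length-++; length-tabulate)
open import Data.List.Membership.Propositional using (_∈_; _∉_)
open import Data.List.Relation.Unary.All as All using (All; []; _∷_)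
open import Data.List.Relation.Unary.All.Properties using () renaming (++⁺ to All-++⁺)
open import Data.List.Relation.Unary.Any as Any using (here; there)
open import Data.List.Relation.Unary.Unique.Propositional using (Unique)
open import Data.List.Relation.Unary.Unique.Propositional.Properties using (allFin⁺; ++⁺)
open import Data.List.Membership.Propositional.Properties
  using (∈-allFin; ∈-++⁺ˡ; ∈-++⁺ʳ; ∈-concatMap⁺; ∈-filter⁺)
open import Data.List.Relation.Unary.AllPairs as AllPairs using ([]; _∷_)
open import Data.Nat using (ℕ; zero; suc; _+_; _∸_; _≤_; _<_; _<ᵇ_; z≤n; s≤s; s≤s⁻¹; z<s)
open import Data.Nat.Properties hiding (_≟_)
open import Data.Product using (_×_; _,_; proj₁; proj₂; map₁)
open import Data.Sum using (_⊎_; inj₁; inj₂; map₂)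
open import Function using (_∘_; id)
open import Relation.Binary.Definitions using (DecidableEquality)
open import Relation.Binary.PropositionalEquality
open import Relation.Nullary using (Dec; yes; no; contradiction)
open import Relation.Nullary.Decidable using (⌊_⌋)

𝟙 : Bool → ℕ
𝟙 true  = 1
𝟙 false = 0

count : {A : Set} → (A → Bool) → List A → ℕ
count P xs = length (filterᵇ P xs)

module _ {A : Set} where

  count-∷ : ∀ (P : A → Bool) x xs → count P (x ∷ xs) ≡ 𝟙 (P x) + count P xs
  count-∷ P x xs with P x
  ... | true  = refl
  ... | false = refl

  count-≗ : ∀ {P Q : A → Bool} → P ≗ Q → ∀ xs → count P xs ≡ count Q xs
  count-≗ P≗Q [] = refl
  count-≗ {P} {Q} P≗Q (x ∷ xs)
    rewrite count-∷ P x xs | count-∷ Q x xs | P≗Q x | count-≗ P≗Q xs = refl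

  count-mono : ∀ {P Q : A → Bool} → (∀ x → P x ≡ true → Q x ≡ true) →
               ∀ xs → count P xs ≤ count Q xs
  count-mono P⇒Q [] = z≤n
  count-mono {P} {Q} P⇒Q (x ∷ xs) rewrite count-∷ P x xs | count-∷ Q x xs with P x in Px
  ... | true  rewrite P⇒Q x Px = s≤s (count-mono P⇒Q xs)
  ... | false = ≤-trans (count-mono P⇒Q xs) (m≤n+m _ _)

  count-none : ∀ {P : A → Bool} {xs} → All (λ x → P x ≡ false) xs → count P xs ≡ 0
  count-none [] = refl
  count-none {P} {x ∷ xs} (Px ∷ Pxs) rewrite count-∷ P x xs | Px = count-none Pxs

  count≤length : ∀ (P : A → Bool) xs → count P xs ≤ length xs
  count≤length P [] = z≤n
  count≤length P (x ∷ xs) rewrite count-∷ P x xs with P x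
  ... | true  = s≤s (count≤length P xs)
  ... | false = m≤n⇒m≤1+n (count≤length P xs)

  count-∧-not : ∀ (P D : A → Bool) xs →
    count (λ x → P x ∧ D x) xs + count (λ x → P x ∧ not (D x)) xs ≡ count P xs
  count-∧-not P D [] = refl
  count-∧-not P D (x ∷ xs)
    rewrite count-∷ (λ x → P x ∧ D x) x xs | count-∷ (λ x → P x ∧ not (D x)) x xs
          | count-∷ P x xs
    with P x | D x
  ... | true  | true  = cong suc (count-∧-not P D xs)
  ... | true  | false = trans (+-suc _ _) (cong suc (count-∧-not P D xs))
  ... | false | _     = count-∧-not P D xs

  count-∨-disjoint : ∀ (P Q : A → Bool) → (∀ x → P x ∧ Q x ≡ false) →
                     ∀ xs → count (λ x → P x ∨ Q x) xs ≡ count P xs + count Q xs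
  count-∨-disjoint P Q disjoint [] = refl
  count-∨-disjoint P Q disjoint (x ∷ xs)
    rewrite count-∷ (λ x → P x ∨ Q x) x xs | count-∷ P x xs | count-∷ Q x xs
    with P x | Q x | disjoint x
  ... | true  | false | _ = cong suc (count-∨-disjoint P Q disjoint xs)
  ... | false | true  | _ = trans (cong suc (count-∨-disjoint P Q disjoint xs)) (sym (+-suc _ _))
  ... | false | false | _ = count-∨-disjoint P Q disjoint xs

  count-filterᵇ : ∀ (P Q : A → Bool) xs → count Q (filterᵇ P xs) ≡ count (λ x → P x ∧ Q x) xs
  count-filterᵇ P Q [] = refl
  count-filterᵇ P Q (x ∷ xs) rewrite count-∷ (λ x → P x ∧ Q x) x xs with P x
  ... | false = count-filterᵇ P Q xs
  ... | true  rewrite count-∷ Q x (filterᵇ P xs) | count-filterᵇ P Q xs = refl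

  module _ (_≟ᴬ_ : DecidableEquality A) where

    ≟-refl : ∀ x → ⌊ x ≟ᴬ x ⌋ ≡ true
    ≟-refl x with x ≟ᴬ x
    ... | yes _   = refl
    ... | no  x≢x = contradiction refl x≢x

    ≟-≢ : ∀ {x y} → x ≢ y → ⌊ x ≟ᴬ y ⌋ ≡ false
    ≟-≢ {x} {y} x≢y with x ≟ᴬ y
    ... | yes x≡y = contradiction x≡y x≢y
    ... | no  _   = refl

    count-∧-≟ : ∀ (P : A → Bool) {x xs} → Unique xs → x ∈ xs →
      count (λ y → P y ∧ ⌊ y ≟ᴬ x ⌋) xs ≡ 𝟙 (P x)
    count-∧-≟ P {x} {x ∷ xs} (x∉xs ∷ _) (here refl) = begin
      count P≟x (x ∷ xs)           ≡⟨ count-∷ P≟x x xs ⟩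
      𝟙 (P≟x x) + count P≟x xs     ≡⟨ cong₂ (λ b m → 𝟙 b + m) (cong (P x ∧_) (≟-refl x))
                                                              (count-none (All.map ≢x x∉xs)) ⟩
      𝟙 (P x ∧ true) + 0           ≡⟨ cong (λ b → 𝟙 b + 0) (∧-identityʳ (P x)) ⟩
      𝟙 (P x) + 0                  ≡⟨ +-identityʳ _ ⟩
      𝟙 (P x)                      ∎
      where
      open ≡-Reasoning
      P≟x : A → Bool
      P≟x y = P y ∧ ⌊ y ≟ᴬ x ⌋
      ≢x : ∀ {y} → x ≢ y → P≟x y ≡ false
      ≢x x≢y = trans (cong (P _ ∧_) (≟-≢ (x≢y ∘ sym))) (∧-zeroʳ _)
    count-∧-≟ P {x} {y ∷ xs} (y∉xs ∷ unique) (there x∈xs) = begin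
      count P≟x (y ∷ xs)        ≡⟨ count-∷ P≟x y xs ⟩
      𝟙 (P≟x y) + count P≟x xs  ≡⟨ cong (λ b → 𝟙 b + count P≟x xs) P≟x-y ⟩
      count P≟x xs              ≡⟨ count-∧-≟ P unique x∈xs ⟩
      𝟙 (P x)                   ∎
      where
      open ≡-Reasoning
      P≟x : A → Bool
      P≟x z = P z ∧ ⌊ z ≟ᴬ x ⌋
      P≟x-y : P≟x y ≡ false
      P≟x-y = trans (cong (P y ∧_) (≟-≢ (All.lookup y∉xs x∈xs))) (∧-zeroʳ (P y))

∧-≡-true : ∀ {a b} → a ∧ b ≡ true → a ≡ true × b ≡ true
∧-≡-true {true} {true} _ = refl , refl

not-≡-true : ∀ {a} → not a ≡ true → a ≡ false
not-≡-true {false} _ = refl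

-- The decrement c ∸ 1 in visit never truncates: a pending decrement keeps the counter positive.
pred-balance : ∀ c b d o → b ≤ d → c + b ≡ d + suc o → c ∸ 1 + b ≡ d + o
pred-balance zero    b d o b≤d b≡d+1+o = contradiction (subst (d <_) (sym b≡d+1+o) (m<m+n d z<s)) (≤⇒≯ b≤d)
pred-balance (suc c) b d o _   balance  = suc-injective (trans balance (+-suc d o))

module Correctness {p : ℕ} (G : PPartiteGraph p) (k : Fin p → ℕ) where

  open Peel G k

  vertices : List V
  vertices = allFin (n G)

  nbrs : V → (V → Bool) → ℕ
  nbrs u P = count (λ y → adj G u y ∧ P y) vertices

  neighbours : V → List V
  neighbours w = filterᵇ (adj G w) vertices

  occurrences : V → List V → ℕ
  occurrences u = count (λ y → ⌊ y ≟ u ⌋)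

  update-≡ : ∀ {A : Set} (f : V → A) x a → update f x a x ≡ a
  update-≡ f x a rewrite ≟-refl _≟_ x = refl

  update-≢ : ∀ {A : Set} (f : V → A) {x} a {y} → y ≢ x → update f x a y ≡ f y
  update-≢ f a y≢x rewrite ≟-≢ _≟_ y≢x = refl

  update-false⁺ : ∀ act {x y} → act y ≡ false → update act x false y ≡ false
  update-false⁺ act {x} {y} ay with y ≟ x
  ... | yes _ = refl
  ... | no  _ = ay

  update-true⁻ : ∀ act {x y} → update act x false y ≡ true → act y ≡ true
  update-true⁻ act {x} {y} active with y ≟ x
  ... | no _ = active

  below⇒< : ∀ {c u} → below c u ≡ true → c u < k (part G u)
  below⇒< {c} {u} b = <ᵇ⇒< (c u) (k (part G u)) (subst T (sym b) _)

  ¬below⇒≥ : ∀ {c u} → below c u ≡ false → k (part G u) ≤ c u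
  ¬below⇒≥ b = ≮⇒≥ (λ c<k → subst T b (<⇒<ᵇ c<k))

  below-update-≢ : ∀ c {x m y} → y ≢ x → below (update c x m) y ≡ below c y
  below-update-≢ c {y = y} y≢x = cong (_<ᵇ k (part G y)) (update-≢ c _ y≢x)

  count-vertices-∧-≟ : ∀ (P : V → Bool) x → count (λ y → P y ∧ ⌊ y ≟ x ⌋) vertices ≡ 𝟙 (P x)
  count-vertices-∧-≟ P x = count-∧-≟ _≟_ P (allFin⁺ (n G)) (∈-allFin x)

  insert : V → (V → Bool) → V → Bool
  insert w D y = D y ∨ ⌊ y ≟ w ⌋

  nbrs-insert : ∀ u D w → D w ≡ false → nbrs u (insert w D) ≡ nbrs u D + 𝟙 (adj G u w)
  nbrs-insert u D w Dw = begin
    nbrs u (insert w D)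
      ≡⟨ count-≗ (λ y → ∧-distribˡ-∨ (adj G u y) (D y) _) vertices ⟩
    count (λ y → (adj G u y ∧ D y) ∨ (adj G u y ∧ ⌊ y ≟ w ⌋)) vertices
      ≡⟨ count-∨-disjoint _ _ disjoint vertices ⟩
    nbrs u D + count (λ y → adj G u y ∧ ⌊ y ≟ w ⌋) vertices
      ≡⟨ cong (nbrs u D +_) (count-vertices-∧-≟ (adj G u) w) ⟩
    nbrs u D + 𝟙 (adj G u w) ∎
    where
    open ≡-Reasoning
    disjoint : ∀ y → (adj G u y ∧ D y) ∧ (adj G u y ∧ ⌊ y ≟ w ⌋) ≡ false
    disjoint y with y ≟ w
    ... | yes refl rewrite Dw | ∧-zeroʳ (adj G u y) = refl
    ... | no  _    rewrite ∧-zeroʳ (adj G u y) = ∧-zeroʳ _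

  count-deactivate : ∀ act u → act u ≡ true →
                     count (update act u false) vertices + 1 ≡ count act vertices
  count-deactivate act u au = begin
    count (update act u false) vertices + 1
      ≡⟨ cong (count (update act u false) vertices +_) (sym (count-vertices-∧-≟ (λ _ → true) u)) ⟩
    count (update act u false) vertices + count (λ y → ⌊ y ≟ u ⌋) vertices
      ≡⟨ count-∨-disjoint _ _ disjoint vertices ⟨
    count (λ y → update act u false y ∨ ⌊ y ≟ u ⌋) vertices
      ≡⟨ count-≗ restore vertices ⟩
    count act vertices ∎
    where
    open ≡-Reasoning
    disjoint : ∀ y → update act u false y ∧ ⌊ y ≟ u ⌋ ≡ false
    disjoint y with y ≟ u
    ... | yes _ = refl
    ... | no  _ = ∧-zeroʳ (act y)
    restore : ∀ y → update act u false y ∨ ⌊ y ≟ u ⌋ ≡ act y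
    restore y with y ≟ u
    ... | yes refl = sym au
    ... | no  _    = ∨-identityʳ (act y)

  ∈-order : ∀ u → u ∈ order
  ∈-order u =
    ∈-concatMap⁺ _ (Any.map (λ { refl → ∈-filter⁺ _ (∈-allFin u) own-part }) (∈-allFin (part G u)))
    where
    own-part : T ⌊ part G u ≟ part G u ⌋
    own-part = subst T (sym (≟-refl _≟_ (part G u))) _

  occurrences-here : ∀ u L → occurrences u (u ∷ L) ≡ suc (occurrences u L)
  occurrences-here u L rewrite count-∷ (λ y → ⌊ y ≟ u ⌋) u L | ≟-refl _≟_ u = refl

  occurrences-there : ∀ {y u} L → y ≢ u → occurrences y (u ∷ L) ≡ occurrences y L
  occurrences-there {y} {u} L y≢u
    rewrite count-∷ (λ x → ⌊ x ≟ y ⌋) u L | ≟-≢ _≟_ (y≢u ∘ sym) = refl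

  occurrences-neighbours : ∀ u w → occurrences u (neighbours w) ≡ 𝟙 (adj G u w)
  occurrences-neighbours u w = begin
    occurrences u (neighbours w)                      ≡⟨ count-filterᵇ (adj G w) _ vertices ⟩
    count (λ y → adj G w y ∧ ⌊ y ≟ u ⌋) vertices      ≡⟨ count-vertices-∧-≟ (adj G w) u ⟩
    𝟙 (adj G w u)                                     ≡⟨ cong 𝟙 (adj-sym G w u) ⟩
    𝟙 (adj G u w)                                     ∎
    where open ≡-Reasoning

  nbrs≤deg : ∀ u P → nbrs u P ≤ deg G u
  nbrs≤deg u P = count-mono (λ _ → proj₁ ∘ ∧-≡-true) vertices

  finalCounter : V → ℕ
  finalCounter = proj₂ (foldl step initial order)

  module Invariants (S : V → Bool) (S-dense : ∀ u → S u ≡ true → k (part G u) ≤ nbrs u S) where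

    S-above-threshold : ∀ {c : ℕ} {D u} → (∀ y → S y ≡ true → D y ≡ false) →
                        deg G u ≤ c + nbrs u D → S u ≡ true → k (part G u) ≤ c
    S-above-threshold {c} {D} {u} S∩D≡∅ deg≤c+D Su = +-cancelʳ-≤ (nbrs u D) _ _ (begin
      k (part G u) + nbrs u D         ≤⟨ +-monoˡ-≤ (nbrs u D) (S-dense u Su) ⟩
      nbrs u S + nbrs u D             ≤⟨ +-monoˡ-≤ (nbrs u D) (count-mono S⇒¬D vertices) ⟩
      nbrs u (not ∘ D) + nbrs u D     ≡⟨ +-comm _ (nbrs u D) ⟩
      nbrs u D + nbrs u (not ∘ D)     ≡⟨ count-∧-not (adj G u) D vertices ⟩
      deg G u                         ≤⟨ deg≤c+D ⟩
      c + nbrs u D                    ∎)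
      where
      open ≤-Reasoning
      S⇒¬D : ∀ y → adj G u y ∧ S y ≡ true → adj G u y ∧ not (D y) ≡ true
      S⇒¬D y e with ∧-≡-true {adj G u y} e
      ... | a , s rewrite a | S∩D≡∅ y s = refl

    -- Checked is the set of vertices already examined in step (3).  Inside the while loop, D is
    -- the set of vertices already dequeued and L the list of neighbours of the dequeued vertex
    -- whose counters are still to be decreased.  Enqueueing a vertex deactivates it, so
    -- fuel-enough shows that the loop's fuel n G never runs out.
    record LoopInvariant (Checked : V → Set) (D : V → Bool) (L : List V) (fuel : ℕ)
                         (act : V → Bool) (c : V → ℕ) (q : List V) : Set where
      field
        balance                  : ∀ u → c u + nbrs u D ≡ deg G u + occurrences u L
        dequeued⇒inactive        : ∀ u → D u ≡ true → act u ≡ false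
        inactive⇒dequeued⊎queued : ∀ u → act u ≡ false → D u ≡ true ⊎ u ∈ q
        queued-fresh             : All (λ w → act w ≡ false × D w ≡ false) q
        queue-unique             : Unique q
        checked-safe             : ∀ u → act u ≡ true → Checked u → below c u ≡ false
        S-active                 : ∀ u → S u ≡ true → act u ≡ true
        fuel-enough              : length q + count act vertices ≤ fuel

    record StepInvariant (Checked : V → Set) (act : V → Bool) (c : V → ℕ) : Set where
      field
        counts-active : ∀ u → c u + nbrs u (not ∘ act) ≡ deg G u
        checked-safe  : ∀ u → act u ≡ true → Checked u → below c u ≡ false
        S-active      : ∀ u → S u ≡ true → act u ≡ true

    LoopInvariantOn : (V → Set) → (V → Bool) → List V → ℕ → State × List V → Set
    LoopInvariantOn Checked D L fuel ((act , c) , q) = LoopInvariant Checked D L fuel act c q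

    StepInvariantOn : (V → Set) → State → Set
    StepInvariantOn Checked (act , c) = StepInvariant Checked act c

    module Visit {Checked D u L fuel act c q}
                 (inv : LoopInvariant Checked D (u ∷ L) fuel act c q) where
      open LoopInvariant inv

      c′ : V → ℕ
      c′ = update c u (c u ∸ 1)

      balance′ : ∀ y → c′ y + nbrs y D ≡ deg G y + occurrences y L
      balance′ y with y ≟ u
      ... | yes refl = pred-balance (c y) (nbrs y D) (deg G y) (occurrences y L)
                         (nbrs≤deg y D)
                         (trans (balance y) (cong (deg G y +_) (occurrences-here y L)))
      ... | no  y≢u  = trans (balance y) (cong (deg G y +_) (occurrences-there L y≢u))

      active⇒undequeued : ∀ y → act y ≡ true → D y ≡ false
      active⇒undequeued y ay with D y in Dy
      ... | false = refl
      ... | true  = contradiction (trans (sym ay) (dequeued⇒inactive y Dy)) λ ()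

      kept : act u ∧ below c′ u ≡ false → LoopInvariant Checked D L fuel act c′ q
      kept keep = record
        { balance = balance′ ; dequeued⇒inactive = dequeued⇒inactive
        ; inactive⇒dequeued⊎queued = inactive⇒dequeued⊎queued ; queued-fresh = queued-fresh
        ; queue-unique = queue-unique ; checked-safe = safe ; S-active = S-active
        ; fuel-enough = fuel-enough }
        where
        safe : ∀ y → act y ≡ true → Checked y → below c′ y ≡ false
        safe y ay checked = by-cases (y ≟ u)
          where
          by-cases : Dec (y ≡ u) → below c′ y ≡ false
          by-cases (yes refl) rewrite ay = keep
          by-cases (no  y≢u)  = trans (below-update-≢ c y≢u) (checked-safe y ay checked)

      S⇒above : ∀ {y} → S y ≡ true → k (part G y) ≤ c′ y
      S⇒above {y} = S-above-threshold (λ x → active⇒undequeued x ∘ S-active x)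
                                      (≤-trans (m≤m+n _ _) (≤-reflexive (sym (balance′ y))))

      deactivated : act u ∧ below c′ u ≡ true →
                    LoopInvariant Checked D L fuel (update act u false) c′ (q ++ u ∷ [])
      deactivated drop = record
        { balance = balance′
        ; dequeued⇒inactive = λ y Dy → update-false⁺ act (dequeued⇒inactive y Dy)
        ; inactive⇒dequeued⊎queued = inactive⇒dequeued⊎queued′
        ; queued-fresh = All-++⁺ (All.map (map₁ (update-false⁺ act)) queued-fresh)
                                 ((update-≡ act u false , active⇒undequeued u au) ∷ [])
        ; queue-unique = ++⁺ queue-unique ([] ∷ []) λ { (u∈q , here refl) → u∉q u∈q }
        ; checked-safe = checked-safe′
        ; S-active = S-active′
        ; fuel-enough = ≤-trans (≤-reflexive fuel-unchanged) fuel-enough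
        }
        where
        au : act u ≡ true
        au = proj₁ (∧-≡-true {act u} drop)
        u-below : below c′ u ≡ true
        u-below = proj₂ (∧-≡-true {act u} drop)
        u∉q : u ∉ q
        u∉q u∈q = contradiction (trans (sym au) (proj₁ (All.lookup queued-fresh u∈q))) λ ()
        act′ : V → Bool
        act′ = update act u false

        inactive⇒dequeued⊎queued′ : ∀ y → act′ y ≡ false → D y ≡ true ⊎ y ∈ q ++ u ∷ []
        inactive⇒dequeued⊎queued′ y inactive with y ≟ u
        ... | yes refl = inj₂ (∈-++⁺ʳ q (here refl))
        ... | no  _    = map₂ ∈-++⁺ˡ (inactive⇒dequeued⊎queued y inactive)

        checked-safe′ : ∀ y → act′ y ≡ true → Checked y → below c′ y ≡ false
        checked-safe′ y active checked with y ≟ u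
        ... | yes refl = contradiction active λ ()
        ... | no  _    = checked-safe y active checked

        S-active′ : ∀ y → S y ≡ true → act′ y ≡ true
        S-active′ y Sy with y ≟ u
        ... | yes refl = contradiction (S⇒above Sy) (<⇒≱ (below⇒< {c′} u-below))
        ... | no  _    = S-active y Sy

        fuel-unchanged : length (q ++ u ∷ []) + count act′ vertices ≡ length q + count act vertices
        fuel-unchanged = begin
          length (q ++ u ∷ []) + count act′ vertices  ≡⟨ cong (_+ count act′ vertices) (length-++ q) ⟩
          (length q + 1) + count act′ vertices        ≡⟨ +-assoc (length q) 1 _ ⟩
          length q + (1 + count act′ vertices)        ≡⟨ cong (length q +_) (+-comm 1 _) ⟩
          length q + (count act′ vertices + 1)        ≡⟨ cong (length q +_) (count-deactivate act u au) ⟩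
          length q + count act vertices               ∎
          where open ≡-Reasoning

    visit-preserves : ∀ {Checked D u L fuel} sq → LoopInvariantOn Checked D (u ∷ L) fuel sq →
                      LoopInvariantOn Checked D L fuel (visit sq u)
    visit-preserves {u = u} ((act , c) , q) inv with act u ∧ below (update c u (c u ∸ 1)) u in cond
    ... | true  = Visit.deactivated inv cond
    ... | false = Visit.kept inv cond

    visits-preserve : ∀ {Checked D fuel} L sq → LoopInvariantOn Checked D L fuel sq →
                      LoopInvariantOn Checked D [] fuel (foldl visit sq L)
    visits-preserve []      sq inv = inv
    visits-preserve (u ∷ L) sq inv = visits-preserve L (visit sq u) (visit-preserves sq inv)

    dequeue-preserves : ∀ {Checked D fuel act c w q} →
                        LoopInvariant Checked D [] (suc fuel) act c (w ∷ q) →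
                        LoopInvariant Checked (insert w D) (neighbours w) fuel act c q
    dequeue-preserves {Checked} {D} {fuel} {act} {c} {w} {q} inv = record
      { balance = balance′
      ; dequeued⇒inactive = dequeued⇒inactive′
      ; inactive⇒dequeued⊎queued = inactive⇒dequeued⊎queued′
      ; queued-fresh = All.zipWith fresh (All.tail queued-fresh , w∉q)
      ; queue-unique = q-unique
      ; checked-safe = checked-safe
      ; S-active = S-active
      ; fuel-enough = s≤s⁻¹ fuel-enough
      }
      where
      open LoopInvariant inv
      w∉q : All (w ≢_) q
      w∉q = AllPairs.head queue-unique
      q-unique : Unique q
      q-unique = AllPairs.tail queue-unique
      aw : act w ≡ false
      aw = proj₁ (All.head queued-fresh)
      Dw : D w ≡ false
      Dw = proj₂ (All.head queued-fresh)

      balance′ : ∀ u → c u + nbrs u (insert w D) ≡ deg G u + occurrences u (neighbours w)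
      balance′ u = begin
        c u + nbrs u (insert w D)             ≡⟨ cong (c u +_) (nbrs-insert u D w Dw) ⟩
        c u + (nbrs u D + 𝟙 (adj G u w))      ≡⟨ +-assoc (c u) _ _ ⟨
        c u + nbrs u D + 𝟙 (adj G u w)        ≡⟨ cong (_+ 𝟙 (adj G u w)) (balance u) ⟩
        deg G u + 0 + 𝟙 (adj G u w)           ≡⟨ cong (_+ 𝟙 (adj G u w)) (+-identityʳ _) ⟩
        deg G u + 𝟙 (adj G u w)               ≡⟨ cong (deg G u +_) (occurrences-neighbours u w) ⟨
        deg G u + occurrences u (neighbours w) ∎
        where open ≡-Reasoning

      dequeued⇒inactive′ : ∀ y → insert w D y ≡ true → act y ≡ false
      dequeued⇒inactive′ y Dy with y ≟ w
      ... | yes refl = aw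
      ... | no  _    = dequeued⇒inactive y (trans (sym (∨-identityʳ (D y))) Dy)

      inactive⇒dequeued⊎queued′ : ∀ y → act y ≡ false → insert w D y ≡ true ⊎ y ∈ q
      inactive⇒dequeued⊎queued′ y ay with inactive⇒dequeued⊎queued y ay
      ... | inj₁ Dy           = inj₁ (cong (_∨ ⌊ y ≟ w ⌋) Dy)
      ... | inj₂ (here refl)  = inj₁ (trans (cong (D y ∨_) (≟-refl _≟_ y)) (∨-zeroʳ (D y)))
      ... | inj₂ (there y∈q) = inj₂ y∈q

      fresh : ∀ {x} → (act x ≡ false × D x ≡ false) × w ≢ x → act x ≡ false × insert w D x ≡ false
      fresh ((ax , Dx) , w≢x) = ax , cong₂ _∨_ Dx (≟-≢ _≟_ (w≢x ∘ sym))

    drained : ∀ {Checked D fuel act c} → LoopInvariant Checked D [] fuel act c [] →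
              StepInvariant Checked act c
    drained {Checked} {D} {fuel} {act} {c} inv = record
      { counts-active = λ u → begin
          c u + nbrs u (not ∘ act)   ≡⟨ cong (c u +_) (count-≗ (cong (adj G u _ ∧_) ∘ D≗¬act) vertices) ⟨
          c u + nbrs u D             ≡⟨ balance u ⟩
          deg G u + 0                ≡⟨ +-identityʳ _ ⟩
          deg G u                    ∎
      ; checked-safe = checked-safe
      ; S-active = S-active
      }
      where
      open LoopInvariant inv
      open ≡-Reasoning
      D≗¬act : ∀ y → D y ≡ not (act y)
      D≗¬act y with act y in ay | D y in Dy
      ... | true  | true  = contradiction (trans (sym ay) (dequeued⇒inactive y Dy)) λ ()
      ... | true  | false = refl
      ... | false | true  = refl
      ... | false | false with inactive⇒dequeued⊎queued y ay
      ...   | inj₁ Dy′ = contradiction (trans (sym Dy) Dy′) λ ()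

    loop-establishes : ∀ fuel {Checked D} s q → LoopInvariantOn Checked D [] fuel (s , q) →
                       StepInvariantOn Checked (loop fuel s q)
    loop-establishes zero       s []      inv = drained inv
    loop-establishes (suc fuel) s []      inv = drained inv
    loop-establishes zero       s (w ∷ q) inv with () ← LoopInvariant.fuel-enough inv
    loop-establishes (suc fuel) s (w ∷ q) inv =
      loop-establishes fuel _ _ (visits-preserve (neighbours w) (s , q) (dequeue-preserves inv))

    peeling-starts : ∀ {Checked act c v} → StepInvariant Checked act c → act v ∧ below c v ≡ true →
      LoopInvariant (λ u → Checked u ⊎ u ≡ v) (not ∘ act) [] (n G) (update act v false) c (v ∷ [])
    peeling-starts {Checked} {act} {c} {v} inv peel = record
      { balance = λ u → trans (counts-active u) (sym (+-identityʳ _))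
      ; dequeued⇒inactive = λ y → update-false⁺ act ∘ not-≡-true
      ; inactive⇒dequeued⊎queued = inactive⇒dequeued⊎queued
      ; queued-fresh = (update-≡ act v false , cong not av) ∷ []
      ; queue-unique = [] ∷ []
      ; checked-safe = checked-safe′
      ; S-active = S-active′
      ; fuel-enough = begin
          1 + count act′ vertices   ≡⟨ +-comm 1 _ ⟩
          count act′ vertices + 1   ≡⟨ count-deactivate act v av ⟩
          count act vertices        ≤⟨ count≤length act vertices ⟩
          length vertices           ≡⟨ length-tabulate id ⟩
          n G                       ∎
      }
      where
      open StepInvariant inv
      open ≤-Reasoning
      act′ : V → Bool
      act′ = update act v false
      av : act v ≡ true
      av = proj₁ (∧-≡-true {act v} peel)
      v-below : below c v ≡ true
      v-below = proj₂ (∧-≡-true {act v} peel)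

      inactive⇒dequeued⊎queued : ∀ y → act′ y ≡ false → not (act y) ≡ true ⊎ y ∈ v ∷ []
      inactive⇒dequeued⊎queued y inactive with y ≟ v
      ... | yes y≡v = inj₂ (here y≡v)
      ... | no  _   = inj₁ (cong not inactive)

      checked-safe′ : ∀ y → act′ y ≡ true → Checked y ⊎ y ≡ v → below c y ≡ false
      checked-safe′ y active (inj₁ checked) = checked-safe y (update-true⁻ act active) checked
      checked-safe′ y active (inj₂ refl)    = contradiction (trans (sym active) (update-≡ act y false)) λ ()

      S-active′ : ∀ y → S y ≡ true → act′ y ≡ true
      S-active′ y Sy with y ≟ v
      ... | yes refl = contradiction
        (S-above-threshold (λ x Sx → cong not (S-active x Sx)) (≤-reflexive (sym (counts-active y))) Sy)
        (<⇒≱ (below⇒< {c} v-below))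
      ... | no  _    = S-active y Sy

    step-preserves : ∀ {Checked} s v → StepInvariantOn Checked s →
                     StepInvariantOn (λ u → Checked u ⊎ u ≡ v) (step s v)
    step-preserves {Checked} (act , c) v inv with act v ∧ below c v in peel
    ... | true  = loop-establishes (n G) _ _ (peeling-starts inv peel)
    ... | false = record
      { counts-active = counts-active ; checked-safe = checked-safe′ ; S-active = S-active }
      where
      open StepInvariant inv
      checked-safe′ : ∀ y → act y ≡ true → Checked y ⊎ y ≡ v → below c y ≡ false
      checked-safe′ y active (inj₁ checked) = checked-safe y active checked
      checked-safe′ y active (inj₂ refl) rewrite active = peel

    StepInvariantOn-weaken : ∀ {Checked Checked′} s → (∀ u → Checked′ u → Checked u) →
                             StepInvariantOn Checked s → StepInvariantOn Checked′ s
    StepInvariantOn-weaken s ⊆ inv = record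
      { counts-active = counts-active
      ; checked-safe = λ u au → checked-safe u au ∘ ⊆ u
      ; S-active = S-active
      }
      where open StepInvariant inv

    steps-preserve : ∀ {Checked} s vs → StepInvariantOn Checked s →
                     StepInvariantOn (λ u → Checked u ⊎ u ∈ vs) (foldl step s vs)
    steps-preserve s []       inv = StepInvariantOn-weaken s (λ { u (inj₁ checked) → checked }) inv
    steps-preserve {Checked} s (v ∷ vs) inv =
      StepInvariantOn-weaken (foldl step (step s v) vs) reassociate
        (steps-preserve (step s v) vs (step-preserves s v inv))
      where
      reassociate : ∀ u → Checked u ⊎ u ∈ v ∷ vs → (Checked u ⊎ u ≡ v) ⊎ u ∈ vs
      reassociate u (inj₁ checked)      = inj₁ (inj₁ checked)
      reassociate u (inj₂ (here u≡v))   = inj₁ (inj₂ u≡v)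
      reassociate u (inj₂ (there u∈vs)) = inj₂ u∈vs

    initial-invariant : StepInvariantOn (λ _ → ⊥) initial
    initial-invariant = record
      { counts-active = λ u →
          trans (cong (deg G u +_) (count-none (All.universal (∧-zeroʳ ∘ adj G u) vertices))) (+-identityʳ _)
      ; checked-safe = λ _ _ ()
      ; S-active = λ _ _ → refl
      }

    final-invariant : StepInvariantOn (λ u → ⊥ ⊎ u ∈ order) (foldl step initial order)
    final-invariant = steps-preserve initial order initial-invariant

    finalActive-dense : ∀ u → finalActive u ≡ true → k (part G u) ≤ nbrs u finalActive
    finalActive-dense u active =
      subst (k (part G u) ≤_) counter≡nbrs (¬below⇒≥ {finalCounter} (checked-safe u active (inj₂ (∈-order u))))
      where
      open StepInvariant final-invariant
      counter≡nbrs : finalCounter u ≡ nbrs u finalActive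
      counter≡nbrs = +-cancelʳ-≡ _ _ _
        (trans (counts-active u) (sym (count-∧-not (adj G u) finalActive vertices)))

    S⊆finalActive : ∀ u → S u ≡ true → finalActive u ≡ true
    S⊆finalActive = StepInvariant.S-active final-invariant

F-endsʳ : ∀ {p} {G : PPartiteGraph p} (H : Subgraph G) u v → F H u v ≡ true → W H v ≡ true
F-endsʳ H u v Fuv = F-ends H v u (trans (F-sym H v u) Fuv)

peel-isDegreeGraph : ∀ {p} (G : PPartiteGraph p) k → IsDegreeGraph k (pPartiteGraphPeel G k)
peel-isDegreeGraph G k v active =
  subst (k (part G v) ≤_) (count-≗ restrict vertices) (finalActive-dense v active)
  where
  open Peel G k
  open Correctness G k
  open Invariants (λ _ → false) (λ _ ())
  restrict : ∀ y → adj G v y ∧ finalActive y ≡ adj G v y ∧ finalActive v ∧ finalActive y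
  restrict y rewrite active = refl

peel-contains : ∀ {p} (G : PPartiteGraph p) k (H : Subgraph G) → IsDegreeGraph k H →
                H ⊆G pPartiteGraphPeel G k
peel-contains G k H H-dense = S⊆finalActive , edges
  where
  open Peel G k
  open Correctness G k
  W-dense : ∀ u → W H u ≡ true → k (part G u) ≤ nbrs u (W H)
  W-dense u Wu = ≤-trans (H-dense u Wu) (count-mono F⇒adj∧W vertices)
    where
    F⇒adj∧W : ∀ y → F H u y ≡ true → adj G u y ∧ W H y ≡ true
    F⇒adj∧W y Fuy rewrite F⊆E H u y Fuy | F-endsʳ H u y Fuy = refl
  open Invariants (W H) W-dense
  edges : ∀ u v → F H u v ≡ true → adj G u v ∧ finalActive u ∧ finalActive v ≡ true
  edges u v Fuv
    rewrite F⊆E H u v Fuv | S⊆finalActive u (F-ends H u v Fuv) | S⊆finalActive v (F-endsʳ H u v Fuv)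
    = refl

corollary1 : ∀ {p : ℕ} (G : PPartiteGraph p) (k : Fin p → ℕ) →
    IsLargestDegreeSubgraph k (pPartiteGraphPeel G k)
corollary1 G k = peel-isDegreeGraph G k , peel-contains G k
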